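{- Consider two-color Babylon played with $2m$ chips in total. Let $S$ be an odd state in which there is exactly one stack $X$ of some color $x$, and let $u$ be the height of $X$. Suppose that $u < m$, that not all stacks of the other color $y$ have height $u/2$, and that at most two stacks of color $y$ have height $u$. Then $S$ is safe.
   Context: Two-color Babylon: the game starts with $2m$ chips, each red or blue, each chip forming its own stack of height $1$. Players Alice (who moves first) and Bob alternate moves; a move consists of choosing two distinct stacks that have the same height or the same top color (or both) and placing one of them on top of the other. The color of a stack is the color of its top chip; the height of a stack is its number of chips. The last player to make a legal move wins. A state is a configuration of stacks (each with a height and a color) reachable in such a game; it is even or odd according to the parity of its number of stacks (Alice moves from even states, Bob from odd states). Safe states are defined recursively: an even state with no legal move is safe; an even state with a legal move is safe if every move from it produces a safe state; an odd state is safe if some move from it produces a safe state. (Equivalently, a safe state is one from which Bob wins with best play.) -}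

module Defs where

open import Data.Nat using (ℕ; _+_; _*_; _%_)
open import Data.Product using (_×_; _,_; proj₁; proj₂; ∃; ∃-syntax)
open import Data.Sum using (_⊎_)
open import Data.List using (List; []; _∷_; length)
open import Data.List.Relation.Unary.All using (All)
open import Data.List.Relation.Binary.Permutation.Propositional using (_↭_)
open import Relation.Binary.PropositionalEquality using (_≡_)
open import Relation.Binary.Construct.Closure.ReflexiveTransitive using (Star)

data Color : Set where
  red blue : Color

-- A stack is (height , color of its top chip).
Stack : Set
Stack = ℕ × Color

height : Stack → ℕ
height = proj₁

color : Stack → Color
color = proj₂

-- A configuration of stacks (order irrelevant; moves are taken up to permutation).
State : Set
State = List Stack

Compatible : Stack → Stack → Set
Compatible a b = height a ≡ height b ⊎ color a ≡ color b

putOn : Stack → Stack → Stack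
putOn a b = (height a + height b , color b)

Move : State → State → Set
Move s t = ∃[ a ] ∃[ b ] ∃[ r ] (s ↭ a ∷ b ∷ r) × Compatible a b × (t ≡ putOn a b ∷ r)

IsEven : State → Set
IsEven s = length s % 2 ≡ 0

IsOdd : State → Set
IsOdd s = length s % 2 ≡ 1

-- Safe states (the recursive definition; the game is finite since each move
-- decreases the number of stacks, so the inductive reading is the intended one).
data Safe : State → Set where
  safeEven : ∀ {s} → IsEven s → (∀ t → Move s t → Safe t) → Safe s
  safeOdd  : ∀ {s} t → IsOdd s → Move s t → Safe t → Safe s

Initial : ℕ → State → Set
Initial m s = (length s ≡ 2 * m) × All (λ st → height st ≡ 1) s

Reachable : ℕ → State → Set
Reachable m s = ∃[ s₀ ] Initial m s₀ × Star Move s₀ s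

-- Bob keeps the lone x-stack X of height u isolated: after each of his moves no y-stack
-- has height u, so X can never be moved and Alice must merge two y-stacks. Bob also
-- keeps a y-stack of height above u/2, or at least three y-stacks of height ≠ u/2;
-- either survives any merge by Alice, so she can never reach a position in which all
-- y-stacks have height u/2. Since the y-stacks outweigh X (u < m), Bob always has a
-- reply restoring both properties, and as the number of stacks drops with every move
-- Alice eventually runs out of moves.
module Submission where

open import Defs
open import Data.Nat using (ℕ; _<_; _≤_; _*_)
open import Data.Product using (_,_)
open import Data.List using (List; _∷_; length; filter)
open import Data.List.Relation.Unary.All using (All)
open import Data.List.Relation.Binary.Permutation.Propositional using (_↭_)
open import Relation.Binary.PropositionalEquality using (_≡_; _≢_)
open import Relation.Nullary using (¬_)
open import Data.Nat.Properties using (_≟_)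

open import Data.Nat using (zero; suc; _+_; _%_; z≤n; s≤s; s≤s⁻¹; _<?_)
open import Data.Nat.Properties
  using (+-assoc; +-comm; +-identityʳ; +-cancelˡ-≡; +-cancelˡ-<; +-mono-<-≤; +-mono-≤;
         *-distribˡ-+; *-monoʳ-≤; *-monoʳ-<; *-cancelˡ-<; *-cancelˡ-≤;
         ≤-refl; ≤-reflexive; ≤-trans; <⇒≤; <-asym; <-≤-trans; <-irrefl; <⇒≢; >⇒≢; ≤∧≢⇒<; ≮⇒≥; ≤⇒≯;
         m<m+n; m<n+m; m≤m+n; m≤n+m; n≤1+n; n≤0⇒n≡0; suc-injective; 0≢1+n; module ≤-Reasoning)
open import Data.Nat.ListAction using (sum)
open import Data.Nat.ListAction.Properties using (sum-↭)
open import Data.Product using (_×_; ∃-syntax; ∃₂; proj₁; proj₂)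
open import Data.Sum using (_⊎_; inj₁; inj₂)
import Data.Sum as Sum
open import Data.Empty using (⊥-elim)
open import Data.List using ([]; _++_; map)
open import Data.List.Relation.Unary.All using ([]; _∷_)
import Data.List.Relation.Unary.All as All
open import Data.List.Relation.Unary.All.Properties using (¬Any⇒All¬; ¬All⇒Any¬; All¬⇒¬Any)
open import Data.List.Relation.Unary.Any using (Any; here; there; any?)
open import Data.List.Membership.Propositional using (_∈_; find)
open import Data.List.Membership.Propositional.Properties using (∈-∃++)
open import Data.List.Relation.Binary.Permutation.Propositional
  using (↭-refl; ↭-prep; ↭-swap; ↭-trans; ↭-sym)
open import Data.List.Relation.Binary.Permutation.Propositional.Properties
  using (All-resp-↭; Any-resp-↭; ∈-resp-↭; ↭-length; drop-∷; filter-↭; shift; shifts; map⁺)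
open import Data.List.Properties using (filter-accept; filter-all; filter-none; filter-some)
open import Relation.Binary.PropositionalEquality using (refl; sym; trans; cong; cong₂; subst)
open import Relation.Binary.Construct.Closure.ReflexiveTransitive using (fold)
open import Relation.Nullary using (yes; no; ¬?)
open import Relation.Unary using (Decidable; ∁)
open import Function using (_∘_; id)

module _ {A : Set} where

  ∈⇒↭∷ : {a : A} {xs : List A} → a ∈ xs → ∃[ ys ] xs ↭ a ∷ ys
  ∈⇒↭∷ a∈xs with ys , zs , refl ← ∈-∃++ a∈xs = ys ++ zs , shift _ ys zs

  Any⇒↭∷ : {P : A → Set} {xs : List A} → Any P xs → ∃₂ λ a ys → P a × xs ↭ a ∷ ys
  Any⇒↭∷ p with a , a∈xs , pa ← find p with ys , ρ ← ∈⇒↭∷ a∈xs = a , ys , pa , ρ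

  ∷-↭-∷-cases : {z a : A} {xs r : List A} → z ∷ xs ↭ a ∷ r →
    (a ≡ z × xs ↭ r) ⊎ ∃[ ys ] xs ↭ a ∷ ys × z ∷ ys ↭ r
  ∷-↭-∷-cases {z} {a} p with ∈-resp-↭ (↭-sym p) (here refl)
  ... | here refl = inj₁ (refl , drop-∷ p)
  ... | there a∈xs with ys , ρ ← ∈⇒↭∷ a∈xs =
    inj₂ (ys , ρ , drop-∷ (↭-trans (↭-swap a z ↭-refl) (↭-trans (↭-prep z (↭-sym ρ)) p)))

  ∷-↭-∷∷-cases : {z a b : A} {xs r : List A} → z ∷ xs ↭ a ∷ b ∷ r →
    (a ≡ z × b ∈ xs) ⊎ (b ≡ z × a ∈ xs) ⊎ ∃[ ys ] xs ↭ a ∷ b ∷ ys × z ∷ ys ↭ r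
  ∷-↭-∷∷-cases p with ∷-↭-∷-cases p
  ... | inj₁ (a≡z , xs↭br) = inj₁ (a≡z , ∈-resp-↭ (↭-sym xs↭br) (here refl))
  ... | inj₂ (ys , xs↭ays , zys↭br) with ∷-↭-∷-cases zys↭br
  ...   | inj₁ (b≡z , _) = inj₂ (inj₁ (b≡z , ∈-resp-↭ (↭-sym xs↭ays) (here refl)))
  ...   | inj₂ (zs , ys↭bzs , zzs↭r) =
    inj₂ (inj₂ (zs , ↭-trans xs↭ays (↭-prep _ ys↭bzs) , zzs↭r))

  count : {P : A → Set} → Decidable P → List A → ℕ
  count P? xs = length (filter P? xs)

  module _ {P : A → Set} (P? : Decidable P) where

    count-↭ : {xs ys : List A} → xs ↭ ys → count P? xs ≡ count P? ys
    count-↭ ρ = ↭-length (filter-↭ P? ρ)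

    count-∷-≤ : (x : A) (xs : List A) → count P? (x ∷ xs) ≤ suc (count P? xs)
    count-∷-≤ x xs with P? x
    ... | yes _ = ≤-refl
    ... | no _ = n≤1+n _

    count-∷-≥ : (x : A) (xs : List A) → count P? xs ≤ count P? (x ∷ xs)
    count-∷-≥ x xs with P? x
    ... | yes _ = n≤1+n _
    ... | no _ = ≤-refl

    count-accept : {x : A} {xs : List A} → P x → count P? (x ∷ xs) ≡ suc (count P? xs)
    count-accept px = cong length (filter-accept P? px)

    count-none : {xs : List A} → All (∁ P) xs → count P? xs ≡ 0
    count-none none = cong length (filter-none P? none)

    count-all : {xs : List A} → All P xs → count P? xs ≡ length xs
    count-all all = cong length (filter-all P? all)

    count≡0⇒All∁ : (xs : List A) → count P? xs ≡ 0 → All (∁ P) xs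
    count≡0⇒All∁ xs c≡0 = ¬Any⇒All¬ xs λ any → <-irrefl (sym c≡0) (filter-some P? any)

suc-odd⇒even : ∀ n → suc n % 2 ≡ 1 → n % 2 ≡ 0
suc-odd⇒even zero _ = refl
suc-odd⇒even (suc zero) ()
suc-odd⇒even (suc (suc n)) = suc-odd⇒even n

suc-even⇒odd : ∀ n → suc n % 2 ≡ 0 → n % 2 ≡ 1
suc-even⇒odd zero ()
suc-even⇒odd (suc zero) _ = refl
suc-even⇒odd (suc (suc n)) = suc-even⇒odd n

↭∷-even⇒odd : {A : Set} {xs ys : List A} {a : A} → xs ↭ a ∷ ys → length xs % 2 ≡ 0 → length ys % 2 ≡ 1
↭∷-even⇒odd {ys = ys} ρ even = suc-even⇒odd (length ys) (subst (λ n → n % 2 ≡ 0) (↭-length ρ) even)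

2*m≡m+m : ∀ m → 2 * m ≡ m + m
2*m≡m+m m = cong (m +_) (+-identityʳ m)

m<2*[m+n] : ∀ m {n} → 0 < n → m < 2 * (m + n)
m<2*[m+n] m {n} n>0 = <-≤-trans (m<m+n m n>0) (m≤m+n (m + n) _)

halves-< : ∀ m n {o} → 2 * m < o → 2 * n ≤ o → m + n < o
halves-< m n {o} 2m<o 2n≤o = *-cancelˡ-< 2 (m + n) o (begin-strict
  2 * (m + n)   ≡⟨ *-distribˡ-+ 2 m n ⟩
  2 * m + 2 * n <⟨ +-mono-<-≤ 2m<o 2n≤o ⟩
  o + o         ≡⟨ 2*m≡m+m o ⟨
  2 * o         ∎)
  where open ≤-Reasoning

2*n≡o⇒o<2*[m+n] : ∀ m n {o} → 0 < m → 2 * n ≡ o → o < 2 * (m + n)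
2*n≡o⇒o<2*[m+n] m n {o} m>0 2n≡o = begin-strict
  o             <⟨ m<n+m o (<-≤-trans m>0 (m≤m+n m _)) ⟩
  2 * m + o     ≡⟨ cong (2 * m +_) 2n≡o ⟨
  2 * m + 2 * n ≡⟨ *-distribˡ-+ 2 m n ⟨
  2 * (m + n)   ∎
  where open ≤-Reasoning

halves-≤ : ∀ m n {o} → 2 * m ≤ o → 2 * n ≤ o → m + n ≤ o
halves-≤ m n {o} 2m≤o 2n≤o = *-cancelˡ-≤ 2 (begin
  2 * (m + n)   ≡⟨ *-distribˡ-+ 2 m n ⟩
  2 * m + 2 * n ≤⟨ +-mono-≤ 2m≤o 2n≤o ⟩
  o + o         ≡⟨ 2*m≡m+m o ⟨
  2 * o         ∎)
  where open ≤-Reasoning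

m<n∧m+o≡2n⇒m<o : ∀ {m n o} → m < n → m + o ≡ 2 * n → m < o
m<n∧m+o≡2n⇒m<o {m} {n} {o} m<n m+o≡2n = +-cancelˡ-< m m o (begin-strict
  m + m ≡⟨ 2*m≡m+m m ⟨
  2 * m <⟨ *-monoʳ-< 2 m<n ⟩
  2 * n ≡⟨ m+o≡2n ⟨
  m + o ∎)
  where open ≤-Reasoning

total : State → ℕ
total s = sum (map height s)

Positive : Stack → Set
Positive st = 0 < height st

total-↭ : {s t : State} → s ↭ t → total s ≡ total t
total-↭ ρ = sum-↭ (map⁺ height ρ)

Merge : State → State → Set
Merge s t = ∃[ a ] ∃[ b ] ∃[ r ] s ↭ a ∷ b ∷ r × t ≡ putOn a b ∷ r

Move⇒Merge : {s t : State} → Move s t → Merge s t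
Move⇒Merge (a , b , r , ρ , _ , t≡) = a , b , r , ρ , t≡

↭-Merge : {s s′ t : State} → s ↭ s′ → Merge s′ t → Merge s t
↭-Merge σ (a , b , r , ρ , t≡) = a , b , r , ↭-trans σ ρ , t≡

Merge-length : {s t : State} → Merge s t → length s ≡ suc (length t)
Merge-length (_ , _ , _ , ρ , refl) = ↭-length ρ

Merge-total : {s t : State} → Merge s t → total s ≡ total t
Merge-total (a , b , r , ρ , refl) = trans (total-↭ ρ) (sym (+-assoc (height a) (height b) (total r)))

All-Merge : {P : Stack → Set} → (∀ a b → P a → P b → P (putOn a b)) →
  {s t : State} → All P s → Merge s t → All P t
All-Merge merge ps (_ , _ , _ , ρ , refl) with All-resp-↭ ρ ps
... | pa ∷ pb ∷ pr = merge _ _ pa pb ∷ pr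

Positive-putOn : (a b : Stack) → Positive a → Positive b → Positive (putOn a b)
Positive-putOn _ _ pa _ = <-≤-trans pa (m≤m+n _ _)

Compatible-sym : {a b : Stack} → Compatible a b → Compatible b a
Compatible-sym = Sum.map sym sym

Move-odd⇒even : {s t : State} → Move s t → IsOdd s → IsEven t
Move-odd⇒even {t = t} move odd =
  suc-odd⇒even (length t) (subst (λ n → n % 2 ≡ 1) (Merge-length (Move⇒Merge move)) odd)

Move-even⇒odd : {s t : State} → Move s t → IsEven s → IsOdd t
Move-even⇒odd {t = t} move even =
  suc-even⇒odd (length t) (subst (λ n → n % 2 ≡ 0) (Merge-length (Move⇒Merge move)) even)

Reachable-invariant : ∀ m {s} → Reachable m s → total s ≡ 2 * m × All Positive s
Reachable-invariant m (s₀ , (len , ones) , play) =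
  fold (λ s t → Invariant s → Invariant t) (λ move later → later ∘ preserves move) id play
    (trans (total-ones ones) len , All.map (λ h≡1 → subst (0 <_) (sym h≡1) ≤-refl) ones)
  where
  Invariant : State → Set
  Invariant s = total s ≡ 2 * m × All Positive s

  total-ones : {s : State} → All (λ st → height st ≡ 1) s → total s ≡ length s
  total-ones [] = refl
  total-ones (h≡1 ∷ ones) = cong₂ _+_ h≡1 (total-ones ones)

  preserves : {s t : State} → Move s t → Invariant s → Invariant t
  preserves move (tot , pos) =
    trans (sym (Merge-total (Move⇒Merge move))) tot , All-Merge Positive-putOn pos (Move⇒Merge move)

module Play (x y : Color) (x≢y : x ≢ y) (u : ℕ) where

  X : Stack
  X = (u , x)

  YStack : Stack → Set
  YStack st = color st ≡ y × Positive st

  AtU Half Big Small : Stack → Set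
  AtU st = height st ≡ u
  Half st = 2 * height st ≡ u
  Big st = u < 2 * height st
  Small st = 2 * height st < u

  atU? : Decidable AtU
  atU? st = height st ≟ u

  half? : Decidable Half
  half? st = 2 * height st ≟ u

  big? : Decidable Big
  big? st = u <? 2 * height st

  notHalf? : Decidable (∁ Half)
  notHalf? = ¬? ∘ half?

  Half⇒¬Big : ∀ st → Half st → ¬ Big st
  Half⇒¬Big _ half = <-irrefl (sym half)

  Big-putOnˡ : ∀ a b → Big a → Big (putOn a b)
  Big-putOnˡ a b big = <-≤-trans big (*-monoʳ-≤ 2 (m≤m+n (height a) (height b)))

  Big-putOnʳ : ∀ a b → Big b → Big (putOn a b)
  Big-putOnʳ a b big = <-≤-trans big (*-monoʳ-≤ 2 (m≤n+m (height b) (height a)))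

  Robust : List Stack → Set
  Robust l = Any Big l ⊎ 3 ≤ count notHalf? l

  Robust⇒¬All-Half : ∀ {l l′} → Robust l → Merge l l′ → ¬ All Half l′
  Robust⇒¬All-Half (inj₁ big) (a , b , _ , ρ , refl) (half ∷ halves) with Any-resp-↭ ρ big
  ... | here big-a = Half⇒¬Big (putOn a b) half (Big-putOnˡ a b big-a)
  ... | there (here big-b) = Half⇒¬Big (putOn a b) half (Big-putOnʳ a b big-b)
  ... | there (there big-r) = All¬⇒¬Any (All.map (λ {st} → Half⇒¬Big st) halves) big-r
  Robust⇒¬All-Half {l} (inj₂ three) (a , b , r , ρ , refl) (_ ∷ halves) = ≤⇒≯ two three
    where
    open ≤-Reasoning
    two : count notHalf? l ≤ 2
    two = begin
      count notHalf? l           ≡⟨ count-↭ notHalf? ρ ⟩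
      count notHalf? (a ∷ b ∷ r) ≤⟨ ≤-trans (count-∷-≤ notHalf? a (b ∷ r))
                                            (s≤s (count-∷-≤ notHalf? b r)) ⟩
      2 + count notHalf? r       ≡⟨ cong (2 +_) (count-none notHalf? (All.map (λ half ¬half → ¬half half)
                                                                              halves)) ⟩
      2                          ∎

  Guarded : List Stack → Set
  Guarded l = All (∁ AtU) l × Robust l

  Reply : List Stack → Set
  Reply rest = ∃[ rest′ ] Merge rest rest′ × Guarded rest′

  ↭-Reply : ∀ {l l′} → l ↭ l′ → Reply l′ → Reply l
  ↭-Reply ρ (r , merge , guarded) = r , ↭-Merge ρ merge , guarded

  guarded-atU : ∀ a b {L} → AtU a → Positive b → All (∁ AtU) L → Guarded (putOn a b ∷ L)
  guarded-atU (_ , _) _ refl b>0 none = (>⇒≢ (m<m+n u b>0) ∷ none) , inj₁ (here (m<2*[m+n] u b>0))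

  reply-atU : ∀ {a H} → AtU a → All Positive H → length H % 2 ≡ 1 → count atU? (a ∷ H) ≤ 2 →
    Reply (a ∷ H)
  reply-atU {H = []} _ _ () _
  reply-atU {a} {b ∷ H} a≡u pos _ few with any? atU? (b ∷ H)
  ... | yes atU-in-H with b′ , H′ , b′≡u , ρ ← Any⇒↭∷ atU-in-H =
    _ , (a , b′ , H′ , ↭-prep a ρ , refl) ,
    guarded-atU a b′ a≡u (All.head (All-resp-↭ ρ pos)) none′
    where
    count-a∷b′∷H′ : count atU? (a ∷ b ∷ H) ≡ 2 + count atU? H′
    count-a∷b′∷H′ = trans (count-↭ atU? (↭-prep a ρ))
                          (trans (count-accept atU? a≡u) (cong suc (count-accept atU? b′≡u)))
    none′ : All (∁ AtU) H′
    none′ = count≡0⇒All∁ atU? H′ (n≤0⇒n≡0 (s≤s⁻¹ (s≤s⁻¹ (subst (_≤ 2) count-a∷b′∷H′ few))))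
  ... | no none =
    _ , (a , b , H , ↭-refl , refl) , guarded-atU a b a≡u (All.head pos) (All.tail (¬Any⇒All¬ _ none))

  reply-big : ∀ {e H} → Big e → All (∁ AtU) (e ∷ H) → u < total (e ∷ H) → length H % 2 ≡ 1 →
    Reply (e ∷ H)
  reply-big {H = []} _ _ _ ()
  reply-big {e} {c ∷ H} big (¬e ∷ ¬c ∷ none) _ _ with height e + height c ≟ u
  ... | no e+c≢u =
    _ , (e , c , H , ↭-refl , refl) , (e+c≢u ∷ none) , inj₁ (here (Big-putOnˡ e c big))
  reply-big {e} {c ∷ []} _ _ heavy _ | yes e+c≡u =
    ⊥-elim (<-irrefl (sym (trans (cong (height e +_) (+-identityʳ (height c))) e+c≡u)) heavy)
  reply-big {e} {c ∷ c′ ∷ H} big (¬e ∷ ¬c ∷ ¬c′ ∷ none) _ _ | yes e+c≡u with height c + height c′ ≟ u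
  ... | no c+c′≢u = _ , (c , c′ , e ∷ H , shifts (e ∷ []) (c ∷ c′ ∷ []) , refl) ,
                    (c+c′≢u ∷ ¬e ∷ none) , inj₁ (there (here big))
  ... | yes c+c′≡u = _ , (e , c′ , c ∷ H , ↭-prep e (↭-swap c c′ ↭-refl) , refl) ,
                    (>⇒≢ e+c′>u ∷ ¬c ∷ none) , inj₁ (here (Big-putOnˡ e c′ big))
    where
    e≡c′ : height e ≡ height c′
    e≡c′ = +-cancelˡ-≡ (height c) (height e) (height c′)
             (trans (+-comm (height c) (height e)) (trans e+c≡u (sym c+c′≡u)))
    e+c′>u : u < height e + height c′
    e+c′>u = subst (u <_) (trans (2*m≡m+m (height e)) (cong (height e +_) e≡c′)) big

  Small⇒¬AtU : ∀ st → Small st → ¬ AtU st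
  Small⇒¬AtU _ small refl = ≤⇒≯ (m≤m+n u _) small

  All-Small⇒¬AtU : ∀ {L} → All Small L → All (∁ AtU) L
  All-Small⇒¬AtU = All.map (λ {st} → Small⇒¬AtU st)

  reply-small : ∀ {d H} → All Small (d ∷ H) → u < total (d ∷ H) → length H % 2 ≡ 1 → Reply (d ∷ H)
  reply-small {H = []} _ _ ()
  reply-small {d} {c ∷ []} (small-d ∷ small-c ∷ []) heavy _ =
    ⊥-elim (<-asym heavy′ (halves-< (height d) (height c) small-d (<⇒≤ small-c)))
    where
    heavy′ : u < height d + height c
    heavy′ = subst (u <_) (cong (height d +_) (+-identityʳ (height c))) heavy
  reply-small {H = _ ∷ _ ∷ []} _ _ ()
  reply-small {d} {c₁ ∷ c₂ ∷ c₃ ∷ []} (s ∷ s₁ ∷ s₂ ∷ s₃ ∷ []) heavy _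
    with u <? 2 * (height d + height c₁)
  ... | yes big =
    _ , (d , c₁ , c₂ ∷ c₃ ∷ [] , ↭-refl , refl) ,
    (<⇒≢ (halves-< (height d) (height c₁) s (<⇒≤ s₁)) ∷ All-Small⇒¬AtU (s₂ ∷ s₃ ∷ [])) , inj₁ (here big)
  ... | no ¬big =
    _ , (c₂ , c₃ , d ∷ c₁ ∷ [] , shifts (d ∷ c₁ ∷ []) (c₂ ∷ c₃ ∷ []) , refl) ,
    (<⇒≢ (halves-< (height c₂) (height c₃) s₂ (<⇒≤ s₃)) ∷ All-Small⇒¬AtU (s ∷ s₁ ∷ [])) , inj₁ (here big₂₃)
    where
    heavy′ : u < (height d + height c₁) + (height c₂ + height c₃)
    heavy′ = subst (u <_)
      (trans (cong (λ k → height d + (height c₁ + (height c₂ + k))) (+-identityʳ (height c₃)))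
             (sym (+-assoc (height d) (height c₁) (height c₂ + height c₃)))) heavy
    -- The two pairs together outweigh u, so they cannot both be at most u/2.
    big₂₃ : u < 2 * (height c₂ + height c₃)
    big₂₃ with u <? 2 * (height c₂ + height c₃)
    ... | yes big = big
    ... | no ¬big′ = ⊥-elim (≤⇒≯ (halves-≤ (height d + height c₁) (height c₂ + height c₃)
                                            (≮⇒≥ ¬big) (≮⇒≥ ¬big′)) heavy′)
  reply-small {d} {c₁ ∷ c₂ ∷ c₃ ∷ c₄ ∷ H} (s ∷ s₁ ∷ smalls) _ _ =
    _ , (d , c₁ , _ , ↭-refl , refl) ,
    (<⇒≢ (halves-< (height d) (height c₁) s (<⇒≤ s₁)) ∷ All-Small⇒¬AtU smalls) , inj₂ three
    where
    three : 3 ≤ count notHalf? (putOn d c₁ ∷ c₂ ∷ c₃ ∷ c₄ ∷ H)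
    three = ≤-trans (s≤s (s≤s (s≤s z≤n)))
              (≤-trans (≤-reflexive (sym (count-all notHalf? (All.map <⇒≢ smalls))))
                       (count-∷-≥ notHalf? (putOn d c₁) _))

  reply-below-half : ∀ {d H} → ¬ Half d → Positive d → All (∁ Big) (d ∷ H) → All (∁ AtU) H →
    u < total (d ∷ H) → length H % 2 ≡ 1 → Reply (d ∷ H)
  reply-below-half {d} {H} ¬half-d d>0 (¬big-d ∷ ¬bigs) none heavy odd with any? half? H
  ... | yes half-in-H with w , H′ , half-w , ρ ← Any⇒↭∷ half-in-H =
    _ , (d , w , H′ , ↭-prep d ρ , refl) ,
    (<⇒≢ (halves-< (height d) (height w) 2d<u (≤-reflexive half-w)) ∷ All.tail (All-resp-↭ ρ none)) ,
    inj₁ (here (2*n≡o⇒o<2*[m+n] (height d) (height w) d>0 half-w))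
    where
    2d<u : 2 * height d < u
    2d<u = ≤∧≢⇒< (≮⇒≥ ¬big-d) ¬half-d
  ... | no no-half = reply-small (All.zipWith (λ (¬big , ¬half) → ≤∧≢⇒< (≮⇒≥ ¬big) ¬half)
                                  (¬big-d ∷ ¬bigs , ¬half-d ∷ ¬Any⇒All¬ H no-half)) heavy odd

  bob-reply : ∀ {rest} → All Positive rest → u < total rest → length rest % 2 ≡ 0 →
    ¬ All Half rest → count atU? rest ≤ 2 → Reply rest
  bob-reply {rest} pos heavy even ¬halves few with any? atU? rest
  ... | yes atU-in with a , H , a≡u , ρ ← Any⇒↭∷ atU-in =
    ↭-Reply ρ (reply-atU a≡u (All.tail (All-resp-↭ ρ pos)) (↭∷-even⇒odd ρ even)
                (subst (_≤ 2) (count-↭ atU? ρ) few))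
  ... | no none-atU with any? big? rest
  ...   | yes big-in with e , H , big , ρ ← Any⇒↭∷ big-in =
    ↭-Reply ρ (reply-big big (All-resp-↭ ρ (¬Any⇒All¬ rest none-atU)) (subst (u <_) (total-↭ ρ) heavy)
                (↭∷-even⇒odd ρ even))
  ...   | no none-big with d , H , ¬half , ρ ← Any⇒↭∷ (¬All⇒Any¬ half? rest ¬halves) =
    ↭-Reply ρ (reply-below-half ¬half (All.head (All-resp-↭ ρ pos))
                (All-resp-↭ ρ (¬Any⇒All¬ rest none-big))
                (All.tail (All-resp-↭ ρ (¬Any⇒All¬ rest none-atU))) (subst (u <_) (total-↭ ρ) heavy)
                (↭∷-even⇒odd ρ even))

  record BobToMove (rest : List Stack) : Set where
    field
      stacks     : All YStack rest
      outweighs  : u < total rest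
      notAllHalf : ¬ All Half rest
      fewAtU     : count atU? rest ≤ 2

  record AliceToMove (rest : List Stack) : Set where
    field
      stacks    : All YStack rest
      outweighs : u < total rest
      guarded   : Guarded rest

  YStack-putOn : ∀ a b → YStack a → YStack b → YStack (putOn a b)
  YStack-putOn a b (_ , a>0) (b≡y , b>0) = b≡y , Positive-putOn a b a>0 b>0

  after-bob : ∀ {rest rest′} → BobToMove rest → Merge rest rest′ → Guarded rest′ → AliceToMove rest′
  after-bob bob merge guarded = record
    { stacks    = All-Merge YStack-putOn stacks merge
    ; outweighs = subst (u <_) (Merge-total merge) outweighs
    ; guarded   = guarded
    }
    where open BobToMove bob

  after-alice : ∀ {rest rest′} → AliceToMove rest → Merge rest rest′ → BobToMove rest′
  after-alice alice merge@(a , b , L , ρ , refl) = record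
    { stacks     = All-Merge YStack-putOn stacks merge
    ; outweighs  = subst (u <_) (Merge-total merge) outweighs
    ; notAllHalf = Robust⇒¬All-Half (proj₂ guarded) merge
    ; fewAtU     = ≤-trans (count-∷-≤ atU? (putOn a b) L) (s≤s (≤-trans (≤-reflexive none-in-L) z≤n))
    }
    where
    open AliceToMove alice
    none-in-L : count atU? L ≡ 0
    none-in-L = count-none atU? (All.tail (All.tail (All-resp-↭ ρ (proj₁ guarded))))

  isolated : ∀ {rest st} → AliceToMove rest → st ∈ rest → ¬ Compatible X st
  isolated alice st∈rest (inj₁ u≡h) = All.lookup (proj₁ (AliceToMove.guarded alice)) st∈rest (sym u≡h)
  isolated alice st∈rest (inj₂ x≡c) =
    x≢y (trans x≡c (proj₁ (All.lookup (AliceToMove.stacks alice) st∈rest)))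

  alice-move : ∀ {s t rest} → AliceToMove rest → s ↭ X ∷ rest → Move s t →
    ∃[ rest′ ] Merge rest rest′ × t ↭ X ∷ rest′
  alice-move alice σ (a , b , r , τ , compatible , refl) with ∷-↭-∷∷-cases (↭-trans (↭-sym σ) τ)
  ... | inj₁ (refl , b∈rest) = ⊥-elim (isolated alice b∈rest compatible)
  ... | inj₂ (inj₁ (refl , a∈rest)) = ⊥-elim (isolated alice a∈rest (Compatible-sym compatible))
  ... | inj₂ (inj₂ (L , ρ , X∷L↭r)) =
    _ , (a , b , L , ρ , refl) , ↭-trans (↭-prep _ (↭-sym X∷L↭r)) (↭-swap _ _ ↭-refl)

  bob-move : ∀ {s rest rest′} → All YStack rest → s ↭ X ∷ rest → Merge rest rest′ →
    ∃[ t ] Move s t × t ↭ X ∷ rest′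
  bob-move stacks σ (a , b , L , ρ , refl) with All-resp-↭ ρ stacks
  ... | (a≡y , _) ∷ (b≡y , _) ∷ _ =
    _ , (a , b , X ∷ L , ↭-trans σ (↭-trans (↭-prep X ρ) (shifts (X ∷ []) (a ∷ b ∷ []))) ,
         inj₂ (trans a≡y (sym b≡y)) , refl) ,
    ↭-swap _ _ ↭-refl

  mutual
    bob-wins : ∀ n {s rest} → length rest ≡ n → IsOdd s → s ↭ X ∷ rest → BobToMove rest → Safe s
    bob-wins n {rest = rest} len odd σ bob =
      bob-plays n len odd σ bob (bob-reply (All.map proj₂ stacks) outweighs even notAllHalf fewAtU)
      where
      open BobToMove bob
      even : length rest % 2 ≡ 0
      even = suc-odd⇒even (length rest) (subst (λ n → n % 2 ≡ 1) (↭-length σ) odd)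

    bob-plays : ∀ n {s rest} → length rest ≡ n → IsOdd s → s ↭ X ∷ rest → BobToMove rest → Reply rest →
      Safe s
    bob-plays zero len _ _ _ (_ , merge , _) = ⊥-elim (0≢1+n (trans (sym len) (Merge-length merge)))
    bob-plays (suc n) len odd σ bob (rest′ , merge , guarded)
      with t , move , t↭ ← bob-move (BobToMove.stacks bob) σ merge =
      safeOdd t odd move
        (alice-wins n (suc-injective (trans (sym (Merge-length merge)) len)) (Move-odd⇒even move odd) t↭
          (after-bob bob merge guarded))

    alice-wins : ∀ n {s rest} → length rest ≡ n → IsEven s → s ↭ X ∷ rest → AliceToMove rest → Safe s
    alice-wins n len even σ alice =
      safeEven even λ _ move →
        alice-plays n len (Move-even⇒odd move even) alice (alice-move alice σ move)

    alice-plays : ∀ n {t rest} → length rest ≡ n → IsOdd t → AliceToMove rest →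
      ∃[ rest′ ] Merge rest rest′ × t ↭ X ∷ rest′ → Safe t
    alice-plays zero len _ _ (_ , merge , _) = ⊥-elim (0≢1+n (trans (sym len) (Merge-length merge)))
    alice-plays (suc n) len odd alice (rest′ , merge , t↭) =
      bob-wins n (suc-injective (trans (sym (Merge-length merge)) len)) odd t↭ (after-alice alice merge)

lemma2 : (m : ℕ) (s : State) → Reachable m s → IsOdd s →
    (x y : Color) → x ≢ y → (u : ℕ) (rest : List Stack) →
    s ↭ (u , x) ∷ rest → All (λ st → color st ≡ y) rest →
    u < m →
    ¬ All (λ st → 2 * height st ≡ u) rest →
    length (filter (λ st → height st ≟ u) rest) ≤ 2 →
    Safe s
lemma2 m s reachable odd x y x≢y u rest σ colours u<m notAllHalf fewAtU =
  bob-wins (length rest) refl odd σ record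
    { stacks     = All.zip (colours , All.tail positive)
    ; outweighs  = m<n∧m+o≡2n⇒m<o u<m (trans (sym (total-↭ σ)) total≡2m)
    ; notAllHalf = notAllHalf
    ; fewAtU     = fewAtU
    }
  where
  open Play x y x≢y u
  total≡2m : total s ≡ 2 * m
  total≡2m = proj₁ (Reachable-invariant m reachable)
  positive : All Positive ((u , x) ∷ rest)
  positive = All-resp-↭ σ (proj₂ (Reachable-invariant m reachable))
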